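{- Let $n \ge 1$ and $t \ge 1$ be integers, and let $\ell$ be the smallest positive integer such that $\ell \nmid n$. Then $s_{nt}'(\mathbb{Z}/n\mathbb{Z}) = (t+1)n - \ell + 1$.
   Context: A sequence over an abelian group $G$ is a finite sequence of elements of $G$ (repetition allowed); a subsequence is obtained by selecting some of its terms (not necessarily consecutive), and its length is the number of terms selected. A sequence is zero-sum if the sum of its terms is $0$. For a positive integer $k$, the modified Erdős–Ginzburg–Ziv constant $s_k'(G)$ is the smallest integer $L$ such that every zero-sum sequence over $G$ of length at least $L$ contains a zero-sum subsequence of length $k$. -}

module Defs where

open import Data.Nat using (ℕ; zero; suc; _+_; _*_; _≤_; _<_; NonZero)
open import Data.Nat.DivMod using (_%_)
open import Data.Nat.Divisibility using (_∣_)
open import Data.Fin using (Fin; toℕ)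
open import Data.List using (List; length; map)
open import Data.Nat.ListAction using (sum)
open import Data.List.Relation.Binary.Sublist.Propositional using (_⊆_)
open import Data.Product using (Σ; _×_)
open import Relation.Binary.PropositionalEquality using (_≡_)
open import Relation.Nullary using (¬_)

-- The cyclic group ℤ/nℤ is represented by Fin n (residues 0..n-1),
-- and a sequence over it by a List (Fin n).
-- A sequence is zero-sum if the sum of its terms is 0 in ℤ/nℤ.
ZeroSum : (n : ℕ) .{{_ : NonZero n}} → List (Fin n) → Set
ZeroSum n xs = sum (map toℕ xs) % n ≡ 0

-- Subsequences: (not necessarily consecutive) sublists.
-- L has the s'_k property: every zero-sum sequence of length ≥ L has a
-- zero-sum subsequence of length k.
SkProp : (n : ℕ) .{{_ : NonZero n}} → (k L : ℕ) → Set
SkProp n k L = (xs : List (Fin n)) → L ≤ length xs → ZeroSum n xs →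
  Σ (List (Fin n)) λ ys → ys ⊆ xs × length ys ≡ k × ZeroSum n ys

IsSk' : (n : ℕ) .{{_ : NonZero n}} → (k L : ℕ) → Set
IsSk' n k L = SkProp n k L × ((M : ℕ) → SkProp n k M → L ≤ M)

IsLeastNonDivisor : ℕ → ℕ → Set
IsLeastNonDivisor n ℓ = 1 ≤ ℓ × ¬ (ℓ ∣ n) × ((m : ℕ) → 1 ≤ m → m < ℓ → m ∣ n)

module Submission where

-- Both bounds rest on the Erdős–Ginzburg–Ziv theorem (EGZ): among any
-- 2n - 1 integers some n have sum divisible by n.  It is proved here for
-- lists of entries with a natural-number weight, selections being taken
-- up to reordering: first for primes p (sort by residue; either p entries
-- share a residue, or p - 1 pairs of distinct residues reach every
-- residue by a Cauchy–Davenport growth argument), then for products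
-- (EGZ(a) extracts 2b - 1 blocks of size a, EGZ(b) combines b of them),
-- hence for all n by strong induction.
--
-- Upper bound: a zero-sum list of length ≥ (t + 2)N + 1 - ℓ loses N
-- entries with zero sum to EGZ(N) repeatedly; in the last step it has
-- 2N - j entries with j < ℓ, so j ∣ N, and the block argument for
-- N = jq still applies because the total sum is divisible by j.
-- Lower bound: with N = sℓ + r, 0 < r < ℓ, the list of NT + r - ℓ
-- copies of s and N - r copies of s + 1 is zero-sum, but every zero-sum
-- subsequence of length NT would need more than NT + r - ℓ copies of s.

open import Defs
open import Data.Nat
  using (ℕ; zero; suc; _+_; _*_; _∸_; _≤_; _<_; z≤n; s≤s; NonZero; >-nonZero⁻¹; _≟_; _≤?_)
open import Data.Nat.Properties
open import Data.Nat.DivMod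
open import Data.Nat.Divisibility
  using (_∣_; divides; quotient; m∣n⇒n≡m*quotient; quotient-<; 1∣_; _∣0; ∣-trans; m∣m*n;
         ∣m∣n⇒∣m+n; ∣m+n∣m⇒∣n; *-monoʳ-∣; ∣⇒≤; m%n≡0⇒n∣m; n∣m⇒m%n≡0)
open import Data.Nat.Primality using (Prime; euclidsLemma; composite?; composite; ¬composite⇒prime)
open import Data.Nat.Induction using (<-rec)
open import Data.Nat.Tactic.RingSolver using (solve-∀)
open import Data.Nat.ListAction using (sum)
open import Data.Nat.ListAction.Properties using (sum-++; sum-↭)
open import Data.List using (List; []; _∷_; _++_; length; map; concat; filter; applyUpTo; zip; take; drop; replicate; [_])
open import Data.Fin using (Fin; toℕ; fromℕ<)
open import Data.Fin.Properties using (toℕ-fromℕ<)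
open import Data.List.Properties
  using (map-++; length-++; ++-assoc; ++-identityʳ; concat-++; filter-accept; filter-reject; filter-all;
         length-applyUpTo; length-map; length-zipWith; length-take; length-drop; take++drop≡id; length-replicate)
open import Data.List.Relation.Binary.Permutation.Propositional
  using (_↭_; ↭-refl; ↭-sym; ↭-trans; ↭-reflexive; prep; swap)
open import Data.List.Relation.Binary.Permutation.Propositional.Properties
  using (map⁺; ↭-empty-inv; ∈-resp-↭; drop-∷; shift; shifts; ++⁺ˡ; ++⁺ʳ; ↭-length)
  renaming (++-comm to ++-comm-↭)
import Data.List.Relation.Binary.Permutation.Propositional as ↭
open import Data.List.Membership.Propositional using (_∈_; find)
open import Data.List.Membership.DecPropositional _≟_ using (_∈?_)
open import Data.List.Relation.Unary.All using (All; []; _∷_)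
import Data.List.Relation.Unary.All as All
import Data.List.Relation.Unary.All.Properties as AllP
open import Data.List.Relation.Unary.AllPairs using ([]; _∷_)
open import Data.List.Relation.Unary.Linked using (Linked; _∷_)
import Data.List.Relation.Unary.Linked as Linked
open import Data.List.Relation.Unary.Linked.Properties using (Linked⇒AllPairs)
open import Data.List.Relation.Unary.Unique.Propositional using (Unique)
import Data.List.Relation.Unary.Unique.Propositional.Properties as Unique
open import Data.List.Membership.Propositional.Properties using (∈-∃++; ∈-++⁻; ∈-++⁺ʳ)
open import Data.List.Relation.Unary.Any using (here)
import Data.List.Relation.Binary.Sublist.Propositional as Sublist
open import Data.Product using (Σ; _×_; _,_; proj₂)
open import Data.Sum using (_⊎_; inj₁; inj₂)
open import Data.Empty using (⊥-elim)
open import Relation.Nullary using (¬_; yes; no; ¬?)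
open import Relation.Binary.PropositionalEquality
  using (_≡_; _≢_; refl; sym; trans; cong; cong₂; subst; subst₂; module ≡-Reasoning)
import Data.List.Sort
import Relation.Binary.Construct.On as On

weight : {A : Set} → (A → ℕ) → List A → ℕ
weight w xs = sum (map w xs)

weight-++ : {A : Set} (w : A → ℕ) (xs ys : List A) → weight w (xs ++ ys) ≡ weight w xs + weight w ys
weight-++ w xs ys = trans (cong sum (map-++ w xs ys)) (sum-++ (map w xs) (map w ys))

weight-↭ : {A : Set} (w : A → ℕ) {xs ys : List A} → xs ↭ ys → weight w xs ≡ weight w ys
weight-↭ w p = sum-↭ (map⁺ w p)

record Selection {A : Set} (w : A → ℕ) (k d : ℕ) (xs : List A) : Set where
  constructor selection
  field
    chosen rest : List A
    split       : xs ↭ chosen ++ rest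
    size        : length chosen ≡ k
    divisible   : d ∣ weight w chosen

selection-length : {A : Set} {w : A → ℕ} {k d : ℕ} {xs : List A} (s : Selection w k d xs) →
  length xs ≡ k + length (Selection.rest s)
selection-length (selection ys zs split size _) =
  trans (↭-length split) (trans (length-++ ys) (cong (_+ length zs) size))

selection-↭ : {A : Set} {w : A → ℕ} {k d : ℕ} {xs ys : List A} → xs ↭ ys →
  Selection w k d ys → Selection w k d xs
selection-↭ xs↭ys (selection ys zs split size dv) = selection ys zs (↭-trans xs↭ys split) size dv

selection-widen : {A : Set} {w : A → ℕ} {k d : ℕ} {xs ys R : List A} → xs ↭ ys ++ R →
  Selection w k d ys → Selection w k d xs
selection-widen {R = R} xs↭ys++R (selection ys zs split size dv) = selection ys (zs ++ R)
  (↭-trans xs↭ys++R (↭-trans (++⁺ʳ R split) (↭-reflexive (++-assoc ys zs R)))) size dv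

EGZ : ℕ → Set₁
EGZ n = ∀ {A : Set} (w : A → ℕ) (xs : List A) → n + n ≤ suc (length xs) → Selection w n n xs

egz-0 : EGZ 0
egz-0 w xs _ = selection [] xs ↭-refl refl (divides 0 refl)

egz-1 : EGZ 1
egz-1 w [] (s≤s ())
egz-1 w (x ∷ xs) _ = selection [ x ] xs ↭-refl refl (1∣ _)

selection-++ : {A : Set} {w : A → ℕ} {k k' d : ℕ} {xs : List A} (s : Selection w k d xs) →
  Selection w k' d (Selection.rest s) → Selection w (k + k') d xs
selection-++ {w = w} (selection ys zs split size dv) (selection ys' zs' split' size' dv') =
  selection (ys ++ ys') zs'
    (↭-trans split (↭-trans (++⁺ˡ ys split') (↭-reflexive (sym (++-assoc ys ys' zs')))))
    (trans (length-++ ys) (cong₂ _+_ size size'))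
    (subst (_ ∣_) (sym (weight-++ w ys ys')) (∣m∣n⇒∣m+n dv dv'))

remove : ℕ → List ℕ → List ℕ
remove q = filter (λ u → ¬? (u ≟ q))

length-remove : ∀ q D → Unique D → length D ≤ suc (length (remove q D))
length-remove q [] _ = z≤n
length-remove q (x ∷ D) (x∉D ∷ uD) with x ≟ q
... | yes refl = s≤s (≤-reflexive (cong length (sym (trans
        (filter-reject (λ u → ¬? (u ≟ q)) {x} (λ ne → ne refl))
        (filter-all (λ u → ¬? (u ≟ q)) (All.map (λ ne e → ne (sym e)) x∉D))))))
... | no x≢q = s≤s (subst (λ z → length D ≤ length z)
        (sym (filter-accept (λ u → ¬? (u ≟ q)) {x} x≢q)) (length-remove q D uD))

remove-bounded : ∀ q D → All (_< suc q) D → All (_< q) (remove q D)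
remove-bounded q [] [] = []
remove-bounded q (x ∷ D) (x< ∷ D<) with x ≟ q
... | yes x≡q = subst (All (_< q)) (sym (filter-reject (λ u → ¬? (u ≟ q)) {x} (λ ne → ne x≡q)))
                  (remove-bounded q D D<)
... | no x≢q = subst (All (_< q)) (sym (filter-accept (λ u → ¬? (u ≟ q)) {x} x≢q))
                 (≤∧≢⇒< (≤-pred x<) x≢q ∷ remove-bounded q D D<)

distinct-bounded-length : ∀ q D → Unique D → All (_< q) D → length D ≤ q
distinct-bounded-length zero [] _ _ = z≤n
distinct-bounded-length zero (x ∷ D) _ (() ∷ _)
distinct-bounded-length (suc q) D uD D< =
  ≤-trans (length-remove q D uD)
          (s≤s (distinct-bounded-length q (remove q D) (Unique.filter⁺ _ uD) (remove-bounded q D D<)))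

distinct-bounded-complete : ∀ q D → Unique D → All (_< q) D → length D ≡ q → ∀ t → t < q → t ∈ D
distinct-bounded-complete q D uD D< |D|≡q t t<q with t ∈? D
... | yes t∈D = t∈D
... | no t∉D = ⊥-elim (<-irrefl refl (≤-trans (s≤s (≤-reflexive (sym |D|≡q)))
                 (distinct-bounded-length q (t ∷ D) (t∉D′ ∷ uD) (t<q ∷ D<))))
  where
    t∉D′ : All (t ≢_) D
    t∉D′ = All.tabulate (λ y∈D t≡y → t∉D (subst (_∈ D) (sym t≡y) y∈D))

map-unique : {A B : Set} {P : A → Set} (f : A → B) → (∀ {u v} → P u → P v → f u ≡ f v → u ≡ v) →
  {D : List A} → All P D → Unique D → Unique (map f D)
map-unique f inj [] [] = []
map-unique f inj (Pu ∷ PD) (u∉D ∷ uD) =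
  AllP.map⁺ (All.zipWith (λ (Pv , u≢v) fu≡fv → u≢v (inj Pu Pv fu≡fv)) (PD , u∉D)) ∷ map-unique f inj PD uD

∤-below : ∀ {m p} → 0 < m → m < p → ¬ (p ∣ m)
∤-below {suc m} _ m<p p∣m = <-irrefl refl (≤-<-trans (∣⇒≤ p∣m) m<p)

module Residues (p : ℕ) .{{_ : NonZero p}} where

  0%p≡0 : 0 % p ≡ 0
  0%p≡0 = m<n⇒m%n≡m (>-nonZero⁻¹ p)

  %-absorbʳ : ∀ x y → (x + y % p) % p ≡ (x + y) % p
  %-absorbʳ x y = begin
    (x + y % p) % p          ≡⟨ %-distribˡ-+ x (y % p) p ⟩
    (x % p + y % p % p) % p  ≡⟨ cong (λ z → (x % p + z) % p) (m%n%n≡m%n y p) ⟩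
    (x % p + y % p) % p      ≡⟨ %-distribˡ-+ x y p ⟨
    (x + y) % p              ∎
    where open ≡-Reasoning

  %-absorbˡ : ∀ x y → (x % p + y) % p ≡ (x + y) % p
  %-absorbˡ x y =
    trans (cong (_% p) (+-comm (x % p) y)) (trans (%-absorbʳ y x) (cong (_% p) (+-comm y x)))

  %-cong-+ʳ : ∀ {x y} c → x % p ≡ y % p → (x + c) % p ≡ (y + c) % p
  %-cong-+ʳ {x} {y} c e =
    trans (sym (%-absorbˡ x c)) (trans (cong (λ z → (z + c) % p) e) (%-absorbˡ y c))

  +-complement : ∀ x {a} → a ≤ p → (x + a + (p ∸ a)) % p ≡ x % p
  +-complement x {a} a≤p =
    trans (cong (_% p) (trans (+-assoc x a (p ∸ a)) (cong (x +_) (m+[n∸m]≡n a≤p)))) ([m+n]%n≡m%n x p)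

  -- Addition is cancellative modulo p: add the complement of c on both sides.
  %-cancel-+ʳ : ∀ {x y} c → (x + c) % p ≡ (y + c) % p → x % p ≡ y % p
  %-cancel-+ʳ {x} {y} c e = begin
    x % p                      ≡⟨ undo x ⟨
    (x + c + (p ∸ c % p)) % p  ≡⟨ %-cong-+ʳ (p ∸ c % p) e ⟩
    (y + c + (p ∸ c % p)) % p  ≡⟨ undo y ⟩
    y % p                      ∎
    where
      open ≡-Reasoning
      undo : ∀ z → (z + c + (p ∸ c % p)) % p ≡ z % p
      undo z = trans (%-cong-+ʳ (p ∸ c % p) (sym (%-absorbʳ z c))) (+-complement z (m%n≤n c p))

  orbit : ℕ → ℕ → ℕ → ℕ
  orbit r d k = (r + k * d) % p

  orbit-suc : ∀ r d k → (orbit r d k + d) % p ≡ orbit r d (suc k)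
  orbit-suc r d k = trans (%-absorbˡ (r + k * d) d)
    (cong (_% p) (trans (+-assoc r (k * d) d) (cong (r +_) (+-comm (k * d) d))))

  module _ (p-prime : Prime p) {d : ℕ} (0<d : 0 < d) (d<p : d < p) where

    orbit-injective : ∀ r {i j} → i < j → j < p → orbit r d i ≢ orbit r d j
    orbit-injective r {i} {j} i<j j<p e with euclidsLemma (j ∸ i) d p-prime p∣[j∸i]*d
      where
        shift-j : r + j * d ≡ (j ∸ i) * d + (r + i * d)
        shift-j = trans (cong (λ z → r + z * d) (sym (m∸n+n≡m (<⇒≤ i<j)))) (rearrange r (j ∸ i) i d)
          where
            rearrange : ∀ r e i d → r + (e + i) * d ≡ e * d + (r + i * d)
            rearrange = solve-∀
        p∣[j∸i]*d : p ∣ (j ∸ i) * d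
        p∣[j∸i]*d = m%n≡0⇒n∣m _ p
          (trans (%-cancel-+ʳ (r + i * d) (trans (cong (_% p) (sym shift-j)) (sym e))) 0%p≡0)
    ... | inj₁ p∣j∸i = ∤-below (m<n⇒0<n∸m i<j) (≤-<-trans (m∸n≤m j i) j<p) p∣j∸i
    ... | inj₂ p∣d   = ∤-below 0<d d<p p∣d

    translation-closed⇒complete : (D : List ℕ) {r₀ : ℕ} → r₀ ∈ D → r₀ < p →
      (∀ {r} → r ∈ D → (r + d) % p ∈ D) → ∀ t → t < p → t ∈ D
    translation-closed⇒complete D {r₀} r₀∈D r₀<p closed t t<p =
      All.lookup (AllP.applyUpTo⁺₁ (orbit r₀ d) p (λ {k} _ → orbit∈D k))
        (distinct-bounded-complete p (applyUpTo (orbit r₀ d) p)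
          (Unique.applyUpTo⁺₁ (orbit r₀ d) p (orbit-injective r₀))
          (AllP.applyUpTo⁺₂ (orbit r₀ d) p (λ k → m%n<n _ p))
          (length-applyUpTo (orbit r₀ d) p) t t<p)
      where
        orbit∈D : ∀ k → orbit r₀ d k ∈ D
        orbit∈D zero = subst (_∈ D) (sym (trans (cong (_% p) (+-identityʳ r₀)) (m<n⇒m%n≡m r₀<p))) r₀∈D
        orbit∈D (suc k) = subst (_∈ D) (orbit-suc r₀ d k) (closed (orbit∈D k))

data Choice {A : Set} : List (A × A) → List A → List A → Set where
  []    : Choice [] [] []
  left  : ∀ {x y P cs os} → Choice P cs os → Choice ((x , y) ∷ P) (x ∷ cs) (y ∷ os)
  right : ∀ {x y P cs os} → Choice P cs os → Choice ((x , y) ∷ P) (y ∷ cs) (x ∷ os)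

unpair : {A : Set} → List (A × A) → List A
unpair [] = []
unpair ((x , y) ∷ P) = x ∷ y ∷ unpair P

choice-↭ : {A : Set} {P : List (A × A)} {cs os : List A} → Choice P cs os → unpair P ↭ cs ++ os
choice-↭ [] = ↭-refl
choice-↭ {cs = x ∷ cs} {y ∷ os} (left c) = prep x (↭-trans (prep y (choice-↭ c)) (↭-sym (shift y cs os)))
choice-↭ {cs = y ∷ cs} {x ∷ os} (right c) = ↭-trans (swap x y (choice-↭ c)) (prep y (↭-sym (shift x cs os)))

choice-length : {A : Set} {P : List (A × A)} {cs os : List A} → Choice P cs os → length cs ≡ length P
choice-length [] = refl
choice-length (left c) = cong suc (choice-length c)
choice-length (right c) = cong suc (choice-length c)

module SortedWindows {A : Set} (key : A → ℕ) where

  _≤ₖ_ : A → A → Set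
  x ≤ₖ y = key x ≤ key y

  between : ∀ {f h} l rest → Linked _≤ₖ_ (f ∷ l ++ h ∷ rest) →
    All (λ z → key f ≤ key z × key z ≤ key h) l
  between [] rest sorted = []
  between {f} {h} (z ∷ l) rest (f≤z ∷ sorted) =
    (f≤z , z≤h) ∷ All.map (λ (z≤u , u≤h) → ≤-trans f≤z z≤u , u≤h) (between l rest sorted)
    where
      z≤h : key z ≤ key h
      z≤h with Linked⇒AllPairs ≤-trans sorted
      ... | z≤later ∷ _ = All.lookup z≤later (∈-++⁺ʳ l (here refl))

  ConstantWindow : ℕ → List A → Set
  ConstantWindow m S = Σ (List A) λ W → Σ (List A) λ O → Σ ℕ λ r →
    (S ↭ W ++ O) × length W ≡ suc m × All (λ z → key z ≡ r) W

  -- In a sorted list F ++ M ++ H with |F| + |M| = m, either some entry of F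
  -- has the same key as the entry m places later (and then so do the m + 1
  -- entries from one to the other), or the entries of F have keys
  -- different from those of the first |F| entries of H.
  window-or-separated : ∀ m F M H → Linked _≤ₖ_ (F ++ M ++ H) → length F + length M ≡ m →
    length F ≤ length H →
    ConstantWindow m (F ++ M ++ H) ⊎ All (λ (x , y) → key x ≢ key y) (zip F H)
  window-or-separated m [] M H sorted |F|+|M|≡m _ = inj₂ []
  window-or-separated m (f ∷ F) M (h ∷ H) sorted |F|+|M|≡m (s≤s |F|≤|H|) with key f ≟ key h
  ... | yes f≡h = inj₁ (f ∷ (F ++ M) ++ [ h ] , H , key f ,
          ↭-reflexive (cong (f ∷_) reassociate) , cong suc |FM|+1≡m ,
          refl ∷ AllP.++⁺ (All.map (λ (f≤u , u≤h) → ≤-antisym (≤-trans u≤h (≤-reflexive (sym f≡h))) f≤u)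
                             (between (F ++ M) H sorted′))
                           (sym f≡h ∷ []))
    where
      sorted′ : Linked _≤ₖ_ (f ∷ (F ++ M) ++ h ∷ H)
      sorted′ = subst (λ z → Linked _≤ₖ_ (f ∷ z)) (sym (++-assoc F M (h ∷ H))) sorted
      reassociate : F ++ M ++ h ∷ H ≡ ((F ++ M) ++ [ h ]) ++ H
      reassociate = trans (sym (++-assoc F M (h ∷ H))) (sym (++-assoc (F ++ M) [ h ] H))
      |FM|+1≡m : length ((F ++ M) ++ [ h ]) ≡ m
      |FM|+1≡m = trans (length-++ (F ++ M)) (trans (+-comm (length (F ++ M)) 1)
                   (trans (cong suc (length-++ F)) |F|+|M|≡m))
  ... | no f≢h with window-or-separated m F (M ++ [ h ]) H
          (subst (Linked _≤ₖ_) (cong (F ++_) (sym (++-assoc M [ h ] H))) (Linked.tail sorted))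
          (trans (cong (length F +_) (trans (length-++ M) (+-comm (length M) 1)))
             (trans (+-suc (length F) (length M)) |F|+|M|≡m)) |F|≤|H|
  ...   | inj₂ separated = inj₂ (f≢h ∷ separated)
  ...   | inj₁ (W , O , r , split , |W| , const) = inj₁ (W , f ∷ O , r ,
          ↭-trans (prep f (subst (_↭ W ++ O) (cong (F ++_) (++-assoc M [ h ] H)) split)) (↭-sym (shift f W O)) ,
          |W| , const)

unpair-zip : {A : Set} (F G : List A) → length F ≤ length G →
  F ++ G ↭ unpair (zip F G) ++ drop (length F) G
unpair-zip [] G _ = ↭-refl
unpair-zip (f ∷ F) (g ∷ G) (s≤s |F|≤|G|) = prep f (↭-trans (shift g F G) (prep g (unpair-zip F G |F|≤|G|)))

-- Its core is a
-- Cauchy–Davenport step: for p prime, choosing one entry from each of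
-- p - 1 pairs with distinct residues, the weight of the choice can be
-- made any residue mod p.
module PairSums {A : Set} (w : A → ℕ) {p : ℕ} .{{_ : NonZero p}} (p-prime : Prime p) where
  open Residues p

  residue : A → ℕ
  residue x = w x % p

  Separated : List (A × A) → Set
  Separated P = All (λ (x , y) → residue x ≢ residue y) P

  Reachable : List (A × A) → ℕ → Set
  Reachable P r = Σ (List A) λ cs → Σ (List A) λ os → Choice P cs os × weight w cs % p ≡ r

  reach-left : ∀ {x y P r} → Reachable P r → Reachable ((x , y) ∷ P) ((residue x + r) % p)
  reach-left {x} (cs , os , c , e) =
    x ∷ cs , _ , left c , trans (%-distribˡ-+ (w x) (weight w cs) p) (cong (λ z → (residue x + z) % p) e)

  reach-right : ∀ {x y P r} → Reachable P r → Reachable ((x , y) ∷ P) ((residue y + r) % p)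
  reach-right {y = y} (cs , os , c , e) =
    y ∷ cs , _ , right c , trans (%-distribˡ-+ (w y) (weight w cs) p) (cong (λ z → (residue y + z) % p) e)

  AllReachable : List (A × A) → Set
  AllReachable P = ∀ t → t < p → Reachable P t

  -- Once every residue is reachable, adding a pair keeps it so: to hit t,
  -- choose x and reach t - residue x from the remaining pairs.
  all-reachable-∷ : ∀ {x y P} → AllReachable P → AllReachable ((x , y) ∷ P)
  all-reachable-∷ {x} {y} {P} all t t<p =
    subst (Reachable ((x , y) ∷ P)) hits-t (reach-left (all ((t + (p ∸ a)) % p) (m%n<n _ p)))
    where
      a : ℕ
      a = residue x
      hits-t : (a + (t + (p ∸ a)) % p) % p ≡ t
      hits-t = begin
        (a + (t + (p ∸ a)) % p) % p  ≡⟨ %-absorbʳ a (t + (p ∸ a)) ⟩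
        (a + (t + (p ∸ a))) % p      ≡⟨ cong (_% p) (sym (+-assoc a t (p ∸ a))) ⟩
        (a + t + (p ∸ a)) % p        ≡⟨ cong (λ z → (z + (p ∸ a)) % p) (+-comm a t) ⟩
        (t + a + (p ∸ a)) % p        ≡⟨ +-complement t (m%n≤n (w x) p) ⟩
        t % p                        ≡⟨ m<n⇒m%n≡m t<p ⟩
        t                            ∎
        where open ≡-Reasoning

  record ReachableSet (P : List (A × A)) : Set where
    field
      residues  : List ℕ
      distinct  : Unique residues
      bounded   : All (_< p) residues
      reachable : All (Reachable P) residues
      size      : length residues ≡ suc (length P)
  open ReachableSet

  -- Adding a separated pair (x , y) makes one more residue reachable, or
  -- all of them: the reachable set grows from D to (a + D) ∪ (b + D), and
  -- if this is no larger than D, then D is closed under translation by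
  -- d = b - a ≠ 0, hence contains every residue.
  module _ (x y : A) (a≢b : residue x ≢ residue y) where
    a b d : ℕ
    a = residue x
    b = residue y
    d = (b + (p ∸ a)) % p

    b+r≡a+[r+d] : ∀ r → ((r + d) % p + a) % p ≡ (b + r) % p
    b+r≡a+[r+d] r = begin
      ((r + d) % p + a) % p                ≡⟨ %-absorbˡ (r + d) a ⟩
      (r + (b + (p ∸ a)) % p + a) % p      ≡⟨ %-cong-+ʳ a (%-absorbʳ r (b + (p ∸ a))) ⟩
      (r + (b + (p ∸ a)) + a) % p          ≡⟨ cong (_% p) (rearrange r b a (p ∸ a)) ⟩
      (b + r + a + (p ∸ a)) % p            ≡⟨ +-complement (b + r) (m%n≤n (w x) p) ⟩
      (b + r) % p                          ∎
      where
        open ≡-Reasoning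
        rearrange : ∀ r b a e → r + (b + e) + a ≡ b + r + a + e
        rearrange = solve-∀

    0<d : 0 < d
    0<d with d ≟ 0
    ... | no d≢0 = n≢0⇒n>0 d≢0
    ... | yes d≡0 = ⊥-elim (a≢b (begin
      a                      ≡⟨ m<n⇒m%n≡m (m%n<n (w x) p) ⟨
      a % p                  ≡⟨ cong (λ z → (z + a) % p) (trans (sym d≡0) (sym (m%n%n≡m%n _ p))) ⟩
      ((0 + d) % p + a) % p  ≡⟨ b+r≡a+[r+d] 0 ⟩
      (b + 0) % p            ≡⟨ cong (_% p) (+-identityʳ b) ⟩
      b % p                  ≡⟨ m<n⇒m%n≡m (m%n<n (w y) p) ⟩
      b                      ∎))
      where open ≡-Reasoning

    translated : ∀ r {u} → u < p → (b + r) % p ≡ (a + u) % p → u ≡ (r + d) % p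
    translated r {u} u<p e = trans (sym (m<n⇒m%n≡m u<p)) (trans (%-cancel-+ʳ a
      (trans (cong (_% p) (+-comm u a)) (trans (sym e) (sym (b+r≡a+[r+d] r))))) (m%n%n≡m%n _ p))

    a+-injective : ∀ {u v} → u < p → v < p → (a + u) % p ≡ (a + v) % p → u ≡ v
    a+-injective {u} {v} u<p v<p e = trans (sym (m<n⇒m%n≡m u<p)) (trans (%-cancel-+ʳ a
      (trans (cong (_% p) (+-comm u a)) (trans e (cong (_% p) (+-comm a v))))) (m<n⇒m%n≡m v<p))

    -- If D is not closed, some r ∈ D has r + d ∉ D, so b + r ∉ a + D.
    grow : ∀ {P} → ReachableSet P → AllReachable ((x , y) ∷ P) ⊎ ReachableSet ((x , y) ∷ P)
    grow {P} R with residues R | distinct R | bounded R | reachable R | size R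
    ... | r₀ ∷ D | uD | D< | reachD | |D| with All.all? (λ r → (r + d) % p ∈? (r₀ ∷ D)) (r₀ ∷ D)
    ...   | yes closed = inj₁ (all-reachable-∷ λ t t<p → All.lookup reachD
              (translation-closed⇒complete p-prime 0<d (m%n<n _ p) (r₀ ∷ D) (here refl)
                 (All.head D<) (All.lookup closed) t t<p))
    ...   | no ¬closed with find (AllP.¬All⇒Any¬ (λ r → (r + d) % p ∈? (r₀ ∷ D)) (r₀ ∷ D) ¬closed)
    ...     | r , r∈D , r+d∉D = inj₂ record
              { residues  = (b + r) % p ∷ map (λ v → (a + v) % p) (r₀ ∷ D)
              ; distinct  = AllP.map⁺ (All.tabulate λ {u} u∈D e →
                              r+d∉D (subst (_∈ r₀ ∷ D) (translated r (All.lookup D< u∈D) e) u∈D))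
                            ∷ map-unique _ a+-injective D< uD
              ; bounded   = m%n<n _ p ∷ AllP.map⁺ (All.universal (λ _ → m%n<n _ p) (r₀ ∷ D))
              ; reachable = reach-right (All.lookup reachD r∈D) ∷ AllP.map⁺ (All.map reach-left reachD)
              ; size      = cong suc (trans (length-map _ (r₀ ∷ D)) |D|)
              }

  reachable-growth : ∀ P → Separated P → AllReachable P ⊎ ReachableSet P
  reachable-growth [] [] = inj₂ record
    { residues = [ 0 ] ; distinct = [] ∷ [] ; bounded = >-nonZero⁻¹ p ∷ []
    ; reachable = ([] , [] , [] , 0%p≡0) ∷ [] ; size = refl }
  reachable-growth ((x , y) ∷ P) (a≢b ∷ sep) with reachable-growth P sep
  ... | inj₁ all = inj₁ (all-reachable-∷ all)
  ... | inj₂ R = grow x y a≢b R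

  separated-pairs-cover : ∀ P → Separated P → suc (length P) ≡ p → AllReachable P
  separated-pairs-cover P sep |P|+1≡p with reachable-growth P sep
  ... | inj₁ all = all
  ... | inj₂ R = λ t t<p → All.lookup (reachable R)
          (distinct-bounded-complete p (residues R) (distinct R) (bounded R) (trans (size R) |P|+1≡p) t t<p)

  weight-constant : ∀ r W → All (λ z → residue z ≡ r) W → weight w W % p ≡ (length W * r) % p
  weight-constant r [] [] = refl
  weight-constant r (z ∷ W) (z≡r ∷ W≡r) = begin
    (w z + weight w W) % p              ≡⟨ %-distribˡ-+ (w z) (weight w W) p ⟩
    (residue z + weight w W % p) % p    ≡⟨ cong₂ (λ u v → (u + v) % p) z≡r (weight-constant r W W≡r) ⟩
    (r + (length W * r) % p) % p        ≡⟨ %-absorbʳ r (length W * r) ⟩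
    (r + length W * r) % p              ∎
    where open ≡-Reasoning

  selection-from-constant : ∀ {S W O r} → S ↭ W ++ O → length W ≡ p →
    All (λ z → residue z ≡ r) W → Selection w p p S
  selection-from-constant {W = W} {r = r} split |W|≡p W≡r = selection W _ split |W|≡p
    (m%n≡0⇒n∣m _ p (begin
      weight w W % p      ≡⟨ weight-constant r W W≡r ⟩
      (length W * r) % p  ≡⟨ cong (λ k → (k * r) % p) |W|≡p ⟩
      (p * r) % p         ≡⟨ cong (_% p) (*-comm p r) ⟩
      (r * p) % p         ≡⟨ m*n%n≡0 r p ⟩
      0                   ∎))
    where open ≡-Reasoning

  -- p - 1 separated pairs and one more entry z contain a selection:
  -- choose from the pairs so that their weight cancels the residue of z.
  selection-from-pairs : ∀ {S} P z R → S ↭ unpair P ++ z ∷ R → Separated P → suc (length P) ≡ p →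
    Selection w p p S
  selection-from-pairs P z R split sep |P|+1≡p
    with separated-pairs-cover P sep |P|+1≡p ((p ∸ residue z) % p) (m%n<n _ p)
  ... | cs , os , c , cs≡-z = selection (z ∷ cs) (os ++ R)
          (↭-trans split (↭-trans (++⁺ʳ (z ∷ R) (choice-↭ c))
             (↭-trans (shift z (cs ++ os) R) (↭-reflexive (cong (z ∷_) (++-assoc cs os R))))))
          (trans (cong suc (choice-length c)) |P|+1≡p)
          (m%n≡0⇒n∣m _ p (begin
            (w z + weight w cs) % p                  ≡⟨ %-absorbʳ (w z) (weight w cs) ⟨
            (w z + weight w cs % p) % p              ≡⟨ cong (λ u → (w z + u) % p) cs≡-z ⟩
            (w z + (p ∸ residue z) % p) % p          ≡⟨ %-absorbʳ (w z) (p ∸ residue z) ⟩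
            (w z + (p ∸ residue z)) % p              ≡⟨ %-absorbˡ (w z) (p ∸ residue z) ⟨
            (0 + residue z + (p ∸ residue z)) % p    ≡⟨ +-complement 0 (m%n≤n (w z) p) ⟩
            0 % p                                    ≡⟨ 0%p≡0 ⟩
            0                                        ∎))
    where open ≡-Reasoning

  open SortedWindows residue

  -- A list sorted by residue, split as F ++ G with p - 1 = |F| < |G|,
  -- contains a selection: compare each entry of F with the one p - 1
  -- places later.
  sorted-selection : ∀ F G → Linked _≤ₖ_ (F ++ G) → suc (length F) ≡ p → length F < length G →
    Selection w p p (F ++ G)
  sorted-selection F G sorted |F|+1≡p |F|<|G|
    with window-or-separated (length F) F [] G sorted (+-identityʳ _) (<⇒≤ |F|<|G|)
  ... | inj₁ (W , O , r , split , |W|≡p , W≡r) = selection-from-constant split (trans |W|≡p |F|+1≡p) W≡r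
  ... | inj₂ sep with drop (length F) G | unpair-zip F G (<⇒≤ |F|<|G|)
                    | subst (0 <_) (sym (length-drop (length F) G)) (m<n⇒0<n∸m |F|<|G|)
  ...   | z ∷ R | split | _ = selection-from-pairs (zip F G) z R split sep
          (trans (cong suc (trans (length-zipWith _,_ F G) (m≤n⇒m⊓n≡m (<⇒≤ |F|<|G|)))) |F|+1≡p)

-- The Erdős–Ginzburg–Ziv theorem for a prime p = m + 1: sorted by
-- residue, 2m + 1 entries split as m entries followed by m + 1 more.
egz-prime : ∀ m → Prime (suc m) → EGZ (suc m)
egz-prime m p-prime {A} w xs 2p≤|xs|+1 =
  selection-↭ (↭-sym (Sort.sort-↭ xs))
    (subst (Selection w (suc m) (suc m)) (take++drop≡id m sorted-xs)
      (sorted-selection (take m sorted-xs) (drop m sorted-xs)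
        (subst (Linked _≤ₖ_) (sym (take++drop≡id m sorted-xs)) (Sort.sort-↗ xs))
        (cong suc |take|≡m)
        (subst₂ _<_ (sym |take|≡m) (sym (length-drop m sorted-xs)) (m+n≤o⇒m≤o∸n (suc m) 2m+1≤|s|))))
  where
    open PairSums w p-prime
    open SortedWindows residue
    module Sort = Data.List.Sort (On.decTotalOrder ≤-decTotalOrder residue)
    sorted-xs : List A
    sorted-xs = Sort.sort xs
    2m+1≤|s| : suc m + m ≤ length sorted-xs
    2m+1≤|s| = subst₂ _≤_ (+-comm m (suc m)) (sym (↭-length (Sort.sort-↭ xs))) (≤-pred 2p≤|xs|+1)
    |take|≡m : length (take m sorted-xs) ≡ m
    |take|≡m = trans (length-take m sorted-xs) (m≤n⇒m⊓n≡m (≤-trans (m≤n+m m (suc m)) 2m+1≤|s|))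

concat-↭ : {A : Set} {xss yss : List (List A)} → xss ↭ yss → concat xss ↭ concat yss
concat-↭ ↭.refl = ↭-refl
concat-↭ (↭.prep xs p) = ++⁺ˡ xs (concat-↭ p)
concat-↭ (↭.swap xs ys p) = ↭-trans (shifts xs ys) (++⁺ˡ ys (++⁺ˡ xs (concat-↭ p)))
concat-↭ (↭.trans p q) = ↭-trans (concat-↭ p) (concat-↭ q)

record Block {A : Set} (w : A → ℕ) (a : ℕ) : Set where
  constructor block
  field
    entries   : List A
    size      : length entries ≡ a
    divisible : a ∣ weight w entries
open Block

module Blocks {A : Set} (w : A → ℕ) (a : ℕ) where

  block-weight : Block w a → ℕ
  block-weight B = quotient (divisible B)

  flatten : List (Block w a) → List A
  flatten bs = concat (map entries bs)

  flatten-++ : ∀ bs cs → flatten (bs ++ cs) ≡ flatten bs ++ flatten cs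
  flatten-++ bs cs = trans (cong concat (map-++ entries bs cs)) (sym (concat-++ (map entries bs) (map entries cs)))

  flatten-↭ : ∀ {bs cs} → bs ↭ cs → flatten bs ↭ flatten cs
  flatten-↭ p = concat-↭ (map⁺ entries p)

  length-flatten : ∀ bs → length (flatten bs) ≡ length bs * a
  length-flatten [] = refl
  length-flatten (B ∷ bs) = trans (length-++ (entries B)) (cong₂ _+_ (size B) (length-flatten bs))

  weight-flatten : ∀ bs → weight w (flatten bs) ≡ a * weight block-weight bs
  weight-flatten [] = sym (*-zeroʳ a)
  weight-flatten (B ∷ bs) = begin
    weight w (entries B ++ flatten bs)                 ≡⟨ weight-++ w (entries B) (flatten bs) ⟩
    weight w (entries B) + weight w (flatten bs)
      ≡⟨ cong₂ _+_ (m∣n⇒n≡m*quotient (divisible B)) (weight-flatten bs) ⟩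
    a * block-weight B + a * weight block-weight bs    ≡⟨ *-distribˡ-+ a (block-weight B) _ ⟨
    a * weight block-weight (B ∷ bs)                   ∎
    where open ≡-Reasoning

  -- If xs contains 2b - 1 disjoint blocks, then applying EGZ(b) to the
  -- block weights picks b blocks forming a selection of size a·b.
  blocks-selection : ∀ {b} → EGZ b → ∀ {xs} bs R → xs ↭ flatten bs ++ R → b + b ≤ suc (length bs) →
    Selection w (a * b) (a * b) xs
  blocks-selection {b} egz-b bs R split 2b≤ with egz-b block-weight bs 2b≤
  ... | selection cs os split′ |cs|≡b b∣cs = selection-widen split (selection (flatten cs) (flatten os)
          (↭-trans (flatten-↭ split′) (↭-reflexive (flatten-++ cs os)))
          (trans (length-flatten cs) (trans (cong (_* a) |cs|≡b) (*-comm b a)))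
          (subst (a * b ∣_) (sym (weight-flatten cs)) (*-monoʳ-∣ a b∣cs)))

  record Extraction (k : ℕ) (xs : List A) : Set where
    constructor extraction
    field
      blocks   : List (Block w a)
      leftover : List A
      split    : xs ↭ flatten blocks ++ leftover
      count    : length blocks ≡ k

  extract-blocks : EGZ a → ∀ k xs → k * a + a ≤ suc (length xs) → Extraction k xs
  extract-blocks egz-a zero xs _ = extraction [] xs ↭-refl refl
  extract-blocks egz-a (suc k) xs enough with egz-a w xs (≤-trans (+-monoˡ-≤ a (m≤m+n a (k * a))) enough)
  ... | s@(selection ys zs split |ys|≡a a∣ys) with extract-blocks egz-a k zs enough′
    where
      enough′ : k * a + a ≤ suc (length zs)
      enough′ = +-cancelˡ-≤ a _ _ (subst₂ _≤_ (+-assoc a (k * a) a)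
                  (trans (cong suc (selection-length s)) (sym (+-suc a _))) enough)
  ...   | extraction bs R split′ |bs|≡k = extraction (block ys |ys|≡a a∣ys ∷ bs) R
          (↭-trans split (↭-trans (++⁺ˡ ys split′) (↭-reflexive (sym (++-assoc ys (flatten bs) R)))))
          (cong suc |bs|≡k)

  extraction-length : ∀ {k xs} (E : Extraction k xs) → length xs ≡ k * a + length (Extraction.leftover E)
  extraction-length (extraction bs R split refl) =
    trans (↭-length split) (trans (length-++ (flatten bs)) (cong (_+ length R) (length-flatten bs)))

  leftover-block : ∀ {k xs} → Extraction k xs → a ∣ weight w xs → length xs ≡ k * a + a →
    Extraction (suc k) xs
  leftover-block {k} {xs} E@(extraction bs R split refl) a∣xs |xs|≡ =
    extraction (block R |R|≡a a∣R ∷ bs) []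
      (↭-trans split (↭-trans (++-comm-↭ (flatten bs) R) (↭-reflexive (sym (++-identityʳ _))))) refl
    where
      |R|≡a : length R ≡ a
      |R|≡a = +-cancelˡ-≡ (k * a) _ _ (trans (sym (extraction-length E)) |xs|≡)
      a∣R : a ∣ weight w R
      a∣R = ∣m+n∣m⇒∣n (subst (a ∣_) (trans (weight-↭ w split) (weight-++ w (flatten bs) R)) a∣xs)
              (subst (a ∣_) (sym (weight-flatten bs)) (m∣m*n _))

-- EGZ is multiplicative: 2ab - 1 entries contain 2b - 1 disjoint blocks
-- of size a, and EGZ(b) combines b of them.
egz-* : ∀ {a b} → EGZ a → EGZ (suc b) → EGZ (a * suc b)
egz-* {a} {b} egz-a egz-b w xs 2ab≤ with Blocks.extract-blocks w a egz-a (b + suc b) xs enough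
  where
    enough : (b + suc b) * a + a ≤ suc (length xs)
    enough = subst (_≤ suc (length xs)) (double a b) 2ab≤
      where
        double : ∀ a b → a * suc b + a * suc b ≡ (b + suc b) * a + a
        double = solve-∀
... | Blocks.extraction bs R split |bs|≡ =
  Blocks.blocks-selection w a egz-b bs R split (≤-reflexive (cong suc (sym |bs|≡)))

-- If the weight is divisible by a, then 2ab - a entries already suffice:
-- after 2b - 2 blocks, the a entries left over form the last block.
egz-*-divisible : ∀ {a b} → EGZ a → EGZ (suc b) → {A : Set} (w : A → ℕ) (xs : List A) →
  length xs + a ≡ a * suc b + a * suc b → a ∣ weight w xs → Selection w (a * suc b) (a * suc b) xs
egz-*-divisible {a} {b} egz-a egz-b w xs |xs|+a≡2ab a∣xs
  with Blocks.leftover-block w a (Blocks.extract-blocks w a egz-a (b + b) xs enough) a∣xs |xs|≡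
  where
    |xs|≡ : length xs ≡ (b + b) * a + a
    |xs|≡ = +-cancelʳ-≡ _ _ _ (trans |xs|+a≡2ab (double a b))
      where
        double : ∀ a b → a * suc b + a * suc b ≡ (b + b) * a + a + a
        double = solve-∀
    enough : (b + b) * a + a ≤ suc (length xs)
    enough = ≤-trans (≤-reflexive (sym |xs|≡)) (n≤1+n _)
... | Blocks.extraction bs R split |bs|≡ =
  Blocks.blocks-selection w a egz-b bs R split (≤-reflexive (cong suc (trans (+-suc b b) (sym |bs|≡))))

egz-mult : ∀ {a b} → EGZ a → EGZ b → EGZ (a * b)
egz-mult {a} {zero} egz-a egz-b = subst EGZ (sym (*-zeroʳ a)) egz-0
egz-mult {a} {suc b} egz-a egz-b = egz-* egz-a egz-b

egz : ∀ n → EGZ n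
egz = <-rec EGZ egz-from-smaller
  where
    egz-from-smaller : ∀ n → (∀ {m} → m < n → EGZ m) → EGZ n
    egz-from-smaller zero _ = egz-0
    egz-from-smaller (suc zero) _ = egz-1
    egz-from-smaller n@(suc (suc k)) smaller with composite? n
    ... | no ¬composite = egz-prime (suc k) (¬composite⇒prime ¬composite)
    ... | yes (composite d<n d∣n) = subst EGZ (sym (m∣n⇒n≡m*quotient d∣n))
            (egz-mult (smaller d<n) (smaller (quotient-< d∣n)))

-- The least non-divisor ℓ of N is at most N + 1, as N + 1 ∤ N (N ≥ 1)
-- and everything divides 0.
least-non-divisor-≤ : ∀ {N ℓ} → IsLeastNonDivisor N ℓ → ℓ ≤ suc N
least-non-divisor-≤ {zero} (_ , ℓ∤0 , _) = ⊥-elim (ℓ∤0 (_ ∣0))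
least-non-divisor-≤ {suc n} {ℓ} (_ , _ , below-ℓ-divides) with ℓ ≤? suc (suc n)
... | yes ℓ≤N+1 = ℓ≤N+1
... | no ℓ≰N+1 =
  ⊥-elim (<-irrefl refl (∣⇒≤ (below-ℓ-divides (suc (suc n)) (s≤s z≤n) (≰⇒> ℓ≰N+1))))

-- 2N - j entries of weight divisible by N, where 0 < j ∣ N, contain a
-- selection of N of them: apply the divisible variant of
-- multiplicativity to N = j·q.
divisor-selection : ∀ {N j} {A : Set} (w : A → ℕ) xs → 0 < j → j ∣ N → length xs + j ≡ N + N →
  N ∣ weight w xs → Selection w N N xs
divisor-selection {N} {j} w xs 0<j j∣N |xs|+j≡2N N∣xs with quotient j∣N | m∣n⇒n≡m*quotient j∣N
... | zero | N≡j*0 = ⊥-elim (<-irrefl (sym j≡0) 0<j)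
  where
    j≡0 : j ≡ 0
    j≡0 = m+n≡0⇒n≡0 (length xs) (trans |xs|+j≡2N (cong (λ n → n + n) (trans N≡j*0 (*-zeroʳ j))))
... | suc q | N≡jq = subst (λ n → Selection w n n xs) (sym N≡jq)
        (egz-*-divisible (egz j) (egz (suc q)) w xs (trans |xs|+j≡2N (cong₂ _+_ N≡jq N≡jq))
          (∣-trans j∣N N∣xs))

module UpperBound {N ℓ : ℕ} (least : IsLeastNonDivisor N ℓ) {A : Set} (w : A → ℕ) where

  -- At least 2N + 1 - ℓ entries of weight divisible by N contain a selection
  -- of N of them: with 2N - j entries for some 0 < j < ℓ, the factor j of
  -- N = jq lets EGZ(j) and EGZ(q) act on blocks.
  upper-base : ∀ xs → suc (N + N) ≤ length xs + ℓ → N ∣ weight w xs → Selection w N N xs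
  upper-base xs enough N∣xs with N + N ≤? suc (length xs)
  ... | yes 2N≤|xs|+1 = egz N w xs 2N≤|xs|+1
  ... | no 2N≰|xs|+1 = divisor-selection w xs (m<n⇒0<n∸m |xs|<2N) j∣N |xs|+j≡2N N∣xs
    where
      |xs|<2N : length xs < N + N
      |xs|<2N = <-trans (n<1+n _) (≰⇒> 2N≰|xs|+1)
      j : ℕ
      j = N + N ∸ length xs
      |xs|+j≡2N : length xs + j ≡ N + N
      |xs|+j≡2N = m+[n∸m]≡n (<⇒≤ |xs|<2N)
      j∣N : j ∣ N
      j∣N = proj₂ (proj₂ least) j (m<n⇒0<n∸m |xs|<2N)
              (+-cancelˡ-< (length xs) _ _ (subst (_< length xs + ℓ) (sym |xs|+j≡2N) enough))

  -- Upper bound: (t + 2)N + 1 - ℓ entries of weight divisible by N contain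
  -- a selection of (t + 1)N of them; remove N entries with EGZ(N) until the
  -- base case is reached.
  upper-bound : ∀ t xs → suc (suc t) * N + 1 ≤ length xs + ℓ → N ∣ weight w xs → Selection w (N * suc t) N xs
  upper-bound zero xs enough N∣xs =
    subst (λ k → Selection w k N xs) (sym (*-identityʳ N))
      (upper-base xs (subst (_≤ length xs + ℓ) (two-N+1 N) enough) N∣xs)
    where
      two-N+1 : ∀ N → 2 * N + 1 ≡ suc (N + N)
      two-N+1 = solve-∀
  upper-bound (suc t) xs enough N∣xs with egz N w xs (m≤n⇒m≤1+n (+-cancelʳ-≤ (suc N) _ _ 3N+1≤|xs|+N+1))
    where
      3N+1≤|xs|+N+1 : N + N + suc N ≤ length xs + suc N
      3N+1≤|xs|+N+1 = ≤-trans (≤-trans (m≤m+n _ (t * N)) (≤-reflexive (rearrange N t)))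
        (≤-trans enough (+-monoʳ-≤ (length xs) (least-non-divisor-≤ least)))
        where
          rearrange : ∀ N t → N + N + suc N + t * N ≡ suc (suc (suc t)) * N + 1
          rearrange = solve-∀
  ... | s@(selection ys zs split |ys|≡N N∣ys) =
    subst (λ k → Selection w k N xs) (sym (*-suc N (suc t))) (selection-++ s (upper-bound t zs enough′ N∣zs))
    where
      enough′ : suc (suc t) * N + 1 ≤ length zs + ℓ
      enough′ = +-cancelˡ-≤ N _ _ (subst₂ _≤_ (rearrange N t)
        (trans (cong (_+ ℓ) (selection-length s)) (+-assoc N (length zs) ℓ)) enough)
        where
          rearrange : ∀ N t → suc (suc (suc t)) * N + 1 ≡ N + (suc (suc t) * N + 1)
          rearrange = solve-∀
      N∣zs : N ∣ weight w zs
      N∣zs = ∣m+n∣m⇒∣n (subst (N ∣_) (trans (weight-↭ w split) (weight-++ w ys zs)) N∣xs) N∣ys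

-- A list that is, up to order, ys ++ zs contains a sublist that is a
-- reordering of ys; this turns selections into genuine subsequences.
↭-++⇒sublist : {A : Set} (xs ys zs : List A) → xs ↭ ys ++ zs →
  Σ (List A) λ ys' → ys' Sublist.⊆ xs × ys' ↭ ys
↭-++⇒sublist [] ys zs p with ys | ↭-empty-inv (↭-sym p)
... | [] | _ = [] , Sublist.[] , ↭-refl
↭-++⇒sublist (x ∷ xs) ys zs p with ∈-++⁻ ys (∈-resp-↭ p (here refl))
... | inj₁ x∈ys with ∈-∃++ x∈ys
...   | h , t , refl with ↭-++⇒sublist xs (h ++ t) zs (drop-∷ (↭-trans p moveˡ))
  where
    moveˡ : (h ++ x ∷ t) ++ zs ↭ x ∷ (h ++ t) ++ zs
    moveˡ = ↭-trans (↭-reflexive (++-assoc h (x ∷ t) zs))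
              (↭-trans (shift x h (t ++ zs)) (↭-reflexive (cong (x ∷_) (sym (++-assoc h t zs)))))
...     | ys' , sub , q = x ∷ ys' , refl Sublist.∷ sub , ↭-trans (prep x q) (↭-sym (shift x h t))
↭-++⇒sublist (x ∷ xs) ys zs p | inj₂ x∈zs with ∈-∃++ x∈zs
...   | h , t , refl with ↭-++⇒sublist xs ys (h ++ t) (drop-∷ (↭-trans p moveʳ))
  where
    moveʳ : ys ++ h ++ x ∷ t ↭ x ∷ ys ++ h ++ t
    moveʳ = ↭-trans (++⁺ˡ ys (shift x h t)) (shift x ys (h ++ t))
...     | ys' , sub , q = ys' , x Sublist.∷ʳ sub , q

selection⇒zero-sum-subsequence : ∀ {N k} .{{_ : NonZero N}} {xs : List (Fin N)} → Selection toℕ k N xs →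
  Σ (List (Fin N)) λ ys → ys Sublist.⊆ xs × length ys ≡ k × ZeroSum N ys
selection⇒zero-sum-subsequence {N} {xs = xs} (selection ys zs split |ys|≡k N∣ys) with ↭-++⇒sublist xs ys zs split
... | ys′ , ys′⊆xs , ys′↭ys =
  ys′ , ys′⊆xs , trans (↭-length ys′↭ys) |ys|≡k ,
  n∣m⇒m%n≡0 _ N (subst (N ∣_) (sym (weight-↭ toℕ ys′↭ys)) N∣ys)

zero-sum-free⇒lower-bound : ∀ {N k M} .{{_ : NonZero N}} (xs : List (Fin N)) → ZeroSum N xs →
  (∀ ys → ys Sublist.⊆ xs → length ys ≡ k → ¬ ZeroSum N ys) → SkProp N k M → length xs < M
zero-sum-free⇒lower-bound {M = M} xs xs-zero-sum free sk with M ≤? length xs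
... | no M≰|xs| = ≰⇒> M≰|xs|
... | yes M≤|xs| with sk xs M≤|xs| xs-zero-sum
...   | ys , ys⊆xs , |ys|≡k , ys-zero-sum = ⊥-elim (free ys ys⊆xs |ys|≡k ys-zero-sum)

weight-replicate : {A : Set} (w : A → ℕ) (k : ℕ) (x : A) → weight w (replicate k x) ≡ k * w x
weight-replicate w zero x = refl
weight-replicate w (suc k) x = cong (w x +_) (weight-replicate w k x)

sublist-replicate : {A : Set} (v : A) (j : ℕ) (ys : List A) → ys Sublist.⊆ replicate j v →
  Σ ℕ λ b → b ≤ j × ys ≡ replicate b v
sublist-replicate v zero [] Sublist.[] = 0 , z≤n , refl
sublist-replicate v (suc j) ys (.v Sublist.∷ʳ sub) with sublist-replicate v j ys sub
... | b , b≤j , refl = b , m≤n⇒m≤1+n b≤j , refl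
sublist-replicate v (suc j) (y ∷ ys) (refl Sublist.∷ sub) with sublist-replicate v j ys sub
... | b , b≤j , refl = suc b , s≤s b≤j , refl

sublist-two-blocks : {A : Set} (u v : A) (c j : ℕ) (ys : List A) → ys Sublist.⊆ replicate c u ++ replicate j v →
  Σ ℕ λ a → Σ ℕ λ b → a ≤ c × b ≤ j × ys ≡ replicate a u ++ replicate b v
sublist-two-blocks u v zero j ys sub with sublist-replicate v j ys sub
... | b , b≤j , refl = 0 , b , z≤n , b≤j , refl
sublist-two-blocks u v (suc c) j ys (.u Sublist.∷ʳ sub) with sublist-two-blocks u v c j ys sub
... | a , b , a≤c , b≤j , refl = a , b , m≤n⇒m≤1+n a≤c , b≤j , refl
sublist-two-blocks u v (suc c) j (y ∷ ys) (refl Sublist.∷ sub) with sublist-two-blocks u v c j ys sub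
... | a , b , a≤c , b≤j , refl = suc a , b , s≤s a≤c , b≤j , refl

-- Write N = sℓ + r with 0 < r < ℓ (as ℓ ∤ N) and
-- take c = NT + r - ℓ copies of s and j = N - r copies of s + 1: a
-- zero-sum sequence of length (T + 1)N - ℓ in which a zero-sum
-- subsequence of length NT could use no copy of s + 1, and so would need
-- NT > c copies of s.
module LowerBound (N t ℓ : ℕ) .{{_ : NonZero N}} .{{_ : NonZero ℓ}}
                  (ℓ≤N+1 : ℓ ≤ suc N) (ℓ∤N : ¬ (ℓ ∣ N)) where
  T s r : ℕ
  T = suc t
  s = N / ℓ
  r = N % ℓ

  0<r : 0 < r
  0<r = n≢0⇒n>0 (λ r≡0 → ℓ∤N (m%n≡0⇒n∣m N ℓ r≡0))

  r+sℓ≡N : r + s * ℓ ≡ N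
  r+sℓ≡N = sym (m≡m%n+[m/n]*n N ℓ)

  r≤N : r ≤ N
  r≤N = ≤-trans (m≤m+n r (s * ℓ)) (≤-reflexive r+sℓ≡N)

  u v : Fin N
  u = fromℕ< (m%n<n s N)
  v = fromℕ< (m%n<n (suc s) N)

  two-valued : ℕ → ℕ → List (Fin N)
  two-valued a b = replicate a u ++ replicate b v

  sum-two-valued : ∀ a b → weight toℕ (two-valued a b) % N ≡ (b + (a + b) * s) % N
  sum-two-valued a b = begin
    weight toℕ (replicate a u ++ replicate b v) % N
      ≡⟨ cong (_% N) (weight-++ toℕ (replicate a u) (replicate b v)) ⟩
    (weight toℕ (replicate a u) + weight toℕ (replicate b v)) % N
      ≡⟨ cong (_% N) (cong₂ _+_ (weight-replicate toℕ a u) (weight-replicate toℕ b v)) ⟩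
    (a * toℕ u + b * toℕ v) % N
      ≡⟨ cong₂ (λ x y → (a * x + b * y) % N) (toℕ-fromℕ< _) (toℕ-fromℕ< _) ⟩
    (a * (s % N) + b * (suc s % N)) % N                ≡⟨ %-distribˡ-+ (a * (s % N)) _ N ⟩
    ((a * (s % N)) % N + (b * (suc s % N)) % N) % N
      ≡⟨ cong₂ (λ x y → (x + y) % N) (*-%-absorb a s) (*-%-absorb b (suc s)) ⟩
    ((a * s) % N + (b * suc s) % N) % N                ≡⟨ %-distribˡ-+ (a * s) (b * suc s) N ⟨
    (a * s + b * suc s) % N                            ≡⟨ cong (_% N) (rearrange a b s) ⟩
    (b + (a + b) * s) % N                              ∎
    where
      open ≡-Reasoning
      *-%-absorb : ∀ a x → (a * (x % N)) % N ≡ (a * x) % N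
      *-%-absorb a x = trans (%-distribˡ-* a (x % N) N)
        (trans (cong (λ z → ((a % N) * z) % N) (m%n%n≡m%n x N)) (sym (%-distribˡ-* a x N)))
      rearrange : ∀ a b s → a * s + b * suc s ≡ b + (a + b) * s
      rearrange = solve-∀

  c j : ℕ
  c = N * T + r ∸ ℓ
  j = N ∸ r

  c+ℓ≡NT+r : c + ℓ ≡ N * T + r
  c+ℓ≡NT+r = m∸n+n≡m (≤-trans ℓ≤N+1 (≤-trans (≤-reflexive (+-comm 1 N)) (+-mono-≤ (m≤m*n N T) 0<r)))

  j+r≡N : j + r ≡ N
  j+r≡N = m∸n+n≡m r≤N

  counterexample : List (Fin N)
  counterexample = two-valued c j

  length-two-valued : ∀ a b → length (two-valued a b) ≡ a + b
  length-two-valued a b = trans (length-++ (replicate a u)) (cong₂ _+_ (length-replicate a) (length-replicate b))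

  length-counterexample : length counterexample + ℓ ≡ suc T * N
  length-counterexample = begin
    length counterexample + ℓ  ≡⟨ cong (_+ ℓ) (length-two-valued c j) ⟩
    c + j + ℓ                  ≡⟨ rearrange c j ℓ ⟩
    (c + ℓ) + j                ≡⟨ cong (_+ j) c+ℓ≡NT+r ⟩
    N * T + r + j              ≡⟨ +-assoc (N * T) r j ⟩
    N * T + (r + j)            ≡⟨ cong (N * T +_) (trans (+-comm r j) j+r≡N) ⟩
    N * T + N                  ≡⟨ *-comm-suc N T ⟩
    suc T * N                  ∎
    where
      open ≡-Reasoning
      rearrange : ∀ c j ℓ → c + j + ℓ ≡ (c + ℓ) + j
      rearrange = solve-∀
      *-comm-suc : ∀ N T → N * T + N ≡ suc T * N
      *-comm-suc = solve-∀

  -- ... and sums to c·s + j·(s + 1) = (T + 1)sN.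
  counterexample-zero-sum : ZeroSum N counterexample
  counterexample-zero-sum = begin
    weight toℕ counterexample % N  ≡⟨ sum-two-valued c j ⟩
    (j + (c + j) * s) % N          ≡⟨ cong (_% N) (+-cancelʳ-≡ _ _ _ weight+N) ⟩
    ((T * s + s) * N) % N          ≡⟨ m*n%n≡0 (T * s + s) N ⟩
    0                              ∎
    where
      open ≡-Reasoning
      weight+N : j + (c + j) * s + N ≡ (T * s + s) * N + N
      weight+N = begin
        j + (c + j) * s + N              ≡⟨ cong (j + (c + j) * s +_) r+sℓ≡N ⟨
        j + (c + j) * s + (r + s * ℓ)    ≡⟨ regroup j c s r ℓ ⟩
        (c + ℓ) * s + j * s + (j + r)    ≡⟨ cong₂ (λ x y → x * s + j * s + y) c+ℓ≡NT+r j+r≡N ⟩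
        (N * T + r) * s + j * s + N      ≡⟨ regroup′ N T r s j ⟩
        N * T * s + (j + r) * s + N      ≡⟨ cong (λ x → N * T * s + x * s + N) j+r≡N ⟩
        N * T * s + N * s + N            ≡⟨ regroup″ N T s ⟩
        (T * s + s) * N + N              ∎
        where
          regroup : ∀ j c s r ℓ → j + (c + j) * s + (r + s * ℓ) ≡ (c + ℓ) * s + j * s + (j + r)
          regroup = solve-∀
          regroup′ : ∀ N T r s j → (N * T + r) * s + j * s + N ≡ N * T * s + (j + r) * s + N
          regroup′ = solve-∀
          regroup″ : ∀ N T s → N * T * s + N * s + N ≡ (T * s + s) * N + N
          regroup″ = solve-∀

  -- A subsequence u^a v^b of length NT sums to b modulo N; as b ≤ j < N it
  -- is zero-sum only if b = 0, which needs a = NT > c.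
  no-zero-sum-subsequence : ∀ ys → ys Sublist.⊆ counterexample → length ys ≡ N * T → ¬ ZeroSum N ys
  no-zero-sum-subsequence ys ys⊆ |ys|≡NT ys-zero-sum with sublist-two-blocks u v c j ys ys⊆
  ... | a , b , a≤c , b≤j , refl = <-irrefl refl (≤-<-trans ℓ≤r (m%n<n N ℓ))
    where
      a+b≡NT : a + b ≡ N * T
      a+b≡NT = trans (sym (length-two-valued a b)) |ys|≡NT
      b%N≡0 : b % N ≡ 0
      b%N≡0 = begin
        b % N                  ≡⟨ [m+kn]%n≡m%n b (T * s) N ⟨
        (b + T * s * N) % N    ≡⟨ cong (λ x → (b + x) % N) (trans (regroup N T s) (cong (_* s) (sym a+b≡NT))) ⟩
        (b + (a + b) * s) % N  ≡⟨ sum-two-valued a b ⟨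
        weight toℕ ys % N      ≡⟨ ys-zero-sum ⟩
        0                      ∎
        where
          open ≡-Reasoning
          regroup : ∀ N T s → T * s * N ≡ N * T * s
          regroup = solve-∀
      b≡0 : b ≡ 0
      b≡0 = trans (sym (m<n⇒m%n≡m (≤-<-trans b≤j (subst (j <_) j+r≡N (m<m+n j 0<r))))) b%N≡0
      ℓ≤r : ℓ ≤ r
      ℓ≤r = +-cancelˡ-≤ (N * T) _ _ (begin
        N * T + ℓ  ≡⟨ cong (_+ ℓ) (trans (sym (+-identityʳ a)) (trans (cong (a +_) (sym b≡0)) a+b≡NT)) ⟨
        a + ℓ      ≤⟨ +-monoˡ-≤ ℓ a≤c ⟩
        c + ℓ      ≡⟨ c+ℓ≡NT+r ⟩
        N * T + r  ∎)
        where open ≤-Reasoning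

  lower-bound : ∀ M → SkProp N (N * T) M → suc T * N + 1 ∸ ℓ ≤ M
  lower-bound M sk = subst (_≤ M) (sym bound≡)
    (zero-sum-free⇒lower-bound counterexample counterexample-zero-sum no-zero-sum-subsequence sk)
    where
      L : ℕ
      L = length counterexample
      bound≡ : suc T * N + 1 ∸ ℓ ≡ suc L
      bound≡ = trans (cong (λ x → x + 1 ∸ ℓ) (sym length-counterexample))
                 (trans (cong (_∸ ℓ) (+-comm (L + ℓ) 1)) (m+n∸n≡m (suc L) ℓ))

theorem1p3 : (n t : ℕ) → (ℓ : ℕ) → IsLeastNonDivisor (suc n) ℓ →
    IsSk' (suc n) (suc n * suc t) (suc (suc t) * suc n + 1 ∸ ℓ)
theorem1p3 n t zero (() , _)
theorem1p3 n t ℓ@(suc _) least@(_ , ℓ∤N , _) =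
  upper , LowerBound.lower-bound N t ℓ (least-non-divisor-≤ least) ℓ∤N
  where
    N bound : ℕ
    N = suc n
    bound = suc (suc t) * N + 1
    upper : SkProp N (N * suc t) (bound ∸ ℓ)
    upper xs bound-ℓ≤|xs| xs-zero-sum = selection⇒zero-sum-subsequence
      (UpperBound.upper-bound least toℕ t xs enough (m%n≡0⇒n∣m _ N xs-zero-sum))
      where
        enough : bound ≤ length xs + ℓ
        enough = ≤-trans (m≤n+m∸n bound ℓ)
          (≤-trans (+-monoʳ-≤ ℓ bound-ℓ≤|xs|) (≤-reflexive (+-comm ℓ (length xs))))
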